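{- Let $M$ be an ada. Then there exists a bijection between the sets $\mathscr{A}(M)\cap M_{\#}^{c}$ and $\mathscr{A}(M)\cap M_{\#}$.
   Context: A $C$-algebra is an algebra $\langle M,\vee,\wedge,\neg\rangle$ of type $(2,2,1)$ satisfying, for all $\alpha,\beta,\gamma$: $\neg\neg\alpha=\alpha$; $\neg(\alpha\wedge\beta)=\neg\alpha\vee\neg\beta$; $(\alpha\wedge\beta)\wedge\gamma=\alpha\wedge(\beta\wedge\gamma)$; $\alpha\wedge(\beta\vee\gamma)=(\alpha\wedge\beta)\vee(\alpha\wedge\gamma)$; $(\alpha\vee\beta)\wedge\gamma=(\alpha\wedge\gamma)\vee(\neg\alpha\wedge\beta\wedge\gamma)$; $\alpha\vee(\alpha\wedge\beta)=\alpha$; $(\alpha\wedge\beta)\vee(\beta\wedge\alpha)=(\beta\wedge\alpha)\vee(\alpha\wedge\beta)$. A $C$-algebra with $T,F,U$ has nullary operations $T,F,U$: $T$ is the two-sided identity for $\wedge$, $F$ the two-sided identity for $\vee$, $U$ the fixed point of $\neg$. An ada is a $C$-algebra with $T,F,U$ together with a unary operation $(\cdot)^{\downarrow}$ satisfying $F^{\downarrow}=F$, $U^{\downarrow}=F$, $T^{\downarrow}=T$, $\alpha\wedge\beta^{\downarrow}=\alpha\wedge(\alpha\wedge\beta)^{\downarrow}$, $\alpha^{\downarrow}\vee\neg(\alpha^{\downarrow})=T$, $\alpha=\alpha^{\downarrow}\vee\alpha$. $M_{\#}=\{\alpha\in M:\alpha\vee\neg\alpha=T\}$ and $M_\#^c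 = M\setminus M_\#$. Order: $a\leq b$ iff $a\vee b=b$. An atom is $a\neq F$ such that every $b$ with $F\leq b\leq a$, $b\neq a$ equals $F$; $\mathscr{A}(M)$ is the set of atoms of $M$. -}

module Defs where

open import Level using (Level; suc)
open import Relation.Binary.PropositionalEquality using (_≡_)
open import Relation.Nullary using (¬_)
open import Data.Product using (Σ; _×_)

record CAlgebra (ℓ : Level) : Set (suc ℓ) where
  infixr 6 _∧_
  infixr 5 _∨_
  field
    Carrier : Set ℓ
    _∨_ : Carrier → Carrier → Carrier
    _∧_ : Carrier → Carrier → Carrier
    ¬' : Carrier → Carrier
    ¬¬-id : ∀ α → ¬' (¬' α) ≡ α
    deMorgan : ∀ α β → ¬' (α ∧ β) ≡ (¬' α ∨ ¬' β)
    ∧-assoc : ∀ α β γ → ((α ∧ β) ∧ γ) ≡ (α ∧ (β ∧ γ))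
    ∧-distribˡ-∨ : ∀ α β γ → (α ∧ (β ∨ γ)) ≡ ((α ∧ β) ∨ (α ∧ γ))
    ∨-∧-distribʳ : ∀ α β γ → ((α ∨ β) ∧ γ) ≡ ((α ∧ γ) ∨ (¬' α ∧ β ∧ γ))
    absorb : ∀ α β → (α ∨ (α ∧ β)) ≡ α
    ∧-comm-∨ : ∀ α β → ((α ∧ β) ∨ (β ∧ α)) ≡ ((β ∧ α) ∨ (α ∧ β))

record CAlgebraTFU (ℓ : Level) : Set (suc ℓ) where
  field
    calg : CAlgebra ℓ
  open CAlgebra calg public
  field
    T F U : Carrier
    T-identityˡ : ∀ α → (T ∧ α) ≡ α
    T-identityʳ : ∀ α → (α ∧ T) ≡ α
    F-identityˡ : ∀ α → (F ∨ α) ≡ α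
    F-identityʳ : ∀ α → (α ∨ F) ≡ α
    U-fixed : ¬' U ≡ U

record Ada (ℓ : Level) : Set (suc ℓ) where
  field
    tfu : CAlgebraTFU ℓ
  open CAlgebraTFU tfu public
  field
    _↓ : Carrier → Carrier
    F↓ : (F ↓) ≡ F
    U↓ : (U ↓) ≡ F
    T↓ : (T ↓) ≡ T
    ↓-∧ : ∀ α β → (α ∧ (β ↓)) ≡ (α ∧ ((α ∧ β) ↓))
    ↓-sharp : ∀ α → ((α ↓) ∨ ¬' (α ↓)) ≡ T
    ↓-∨ : ∀ α → α ≡ ((α ↓) ∨ α)

module AdaNotions {ℓ : Level} (M : Ada ℓ) where
  open Ada M

  _≤_ : Carrier → Carrier → Set ℓ
  a ≤ b = (a ∨ b) ≡ b

  Sharp : Carrier → Set ℓ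
  Sharp α = (α ∨ ¬' α) ≡ T

  IsAtom : Carrier → Set ℓ
  IsAtom a = ¬ (a ≡ F) × (∀ b → F ≤ b → b ≤ a → ¬ (b ≡ a) → b ≡ F)

  AtomsSharp : Set ℓ
  AtomsSharp = Σ Carrier (λ a → IsAtom a × Sharp a)

  AtomsNonSharp : Set ℓ
  AtomsNonSharp = Σ Carrier (λ a → IsAtom a × ¬ Sharp a)

-- A bijection between two subsets of a carrier, given as Σ-types, with
-- injectivity/surjectivity measured on the underlying elements (so that
-- proof components of subset membership are irrelevant; needed since the
-- setting is --without-K and has no function extensionality).
open import Data.Product using (proj₁)
record SubsetBijection {ℓ : Level} {A : Set ℓ} (P Q : A → Set ℓ) : Set ℓ where
  field
    to : Σ A P → Σ A Q
    injective : ∀ (x y : Σ A P) → proj₁ (to x) ≡ proj₁ (to y) → proj₁ x ≡ proj₁ y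
    surjective : ∀ (y : Σ A Q) → Σ (Σ A P) (λ x → proj₁ (to x) ≡ proj₁ y)

module AdaBij {ℓ : Level} (M : Ada ℓ) where
  open Ada M
  open AdaNotions M
  BijAtoms : Set ℓ
  BijAtoms = SubsetBijection (λ a → IsAtom a × ¬ Sharp a) (λ a → IsAtom a × Sharp a)

-- The bijection sends a non-sharp atom a to  a ↑ = ¬((¬a)↓)  and is inverted by
-- b ↦ b ∧ U.
-- The theorem then packages ↑ as the bijection: injectivity and surjectivity are
-- exactly the two retractions.

module Submission where

open import Defs
open import Level using (Level)
open import Relation.Binary.PropositionalEquality
open import Relation.Nullary using (¬_)
open import Data.Product using (Σ; _×_; _,_; proj₁)

module CAlgebraLaws {ℓ : Level} (A : CAlgebraTFU ℓ) where
  open CAlgebraTFU A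
  open ≡-Reasoning

  ¬-injective : ∀ {a b} → ¬' a ≡ ¬' b → a ≡ b
  ¬-injective {a} {b} p = trans (sym (¬¬-id a)) (trans (cong ¬' p) (¬¬-id b))

  ¬-∨ : ∀ a b → ¬' (a ∨ b) ≡ (¬' a ∧ ¬' b)
  ¬-∨ a b = begin
    ¬' (a ∨ b)                 ≡⟨ cong ¬' (cong₂ _∨_ (sym (¬¬-id a)) (sym (¬¬-id b))) ⟩
    ¬' (¬' (¬' a) ∨ ¬' (¬' b)) ≡⟨ cong ¬' (sym (deMorgan (¬' a) (¬' b))) ⟩
    ¬' (¬' (¬' a ∧ ¬' b))      ≡⟨ ¬¬-id _ ⟩
    ¬' a ∧ ¬' b                ∎

  ¬T≡F : ¬' T ≡ F
  ¬T≡F = begin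
    ¬' T                ≡⟨ sym (F-identityʳ _) ⟩
    ¬' T ∨ F            ≡⟨ cong (¬' T ∨_) (sym (¬¬-id F)) ⟩
    ¬' T ∨ ¬' (¬' F)    ≡⟨ sym (deMorgan T (¬' F)) ⟩
    ¬' (T ∧ ¬' F)       ≡⟨ cong ¬' (T-identityˡ _) ⟩
    ¬' (¬' F)           ≡⟨ ¬¬-id F ⟩
    F                   ∎

  ¬F≡T : ¬' F ≡ T
  ¬F≡T = trans (cong ¬' (sym ¬T≡F)) (¬¬-id T)

  ∨-relative : ∀ a b → a ∨ b ≡ a ∨ (¬' a ∧ b)
  ∨-relative a b = begin
    a ∨ b                       ≡⟨ sym (T-identityʳ _) ⟩
    (a ∨ b) ∧ T                 ≡⟨ ∨-∧-distribʳ a b T ⟩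
    (a ∧ T) ∨ (¬' a ∧ (b ∧ T))  ≡⟨ cong₂ (λ u v → u ∨ (¬' a ∧ v)) (T-identityʳ a) (T-identityʳ b) ⟩
    a ∨ (¬' a ∧ b)              ∎

  ∧-relative : ∀ a b → a ∧ b ≡ a ∧ (¬' a ∨ b)
  ∧-relative a b = ¬-injective (begin
    ¬' (a ∧ b)                  ≡⟨ deMorgan a b ⟩
    ¬' a ∨ ¬' b                 ≡⟨ ∨-relative (¬' a) (¬' b) ⟩
    ¬' a ∨ (¬' (¬' a) ∧ ¬' b)   ≡⟨ cong (¬' a ∨_) (sym (¬-∨ (¬' a) b)) ⟩
    ¬' a ∨ ¬' (¬' a ∨ b)        ≡⟨ sym (deMorgan a (¬' a ∨ b)) ⟩
    ¬' (a ∧ (¬' a ∨ b))         ∎)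

  ∧-absorb : ∀ a b → a ∧ (a ∨ b) ≡ a
  ∧-absorb a b = ¬-injective (begin
    ¬' (a ∧ (a ∨ b))      ≡⟨ deMorgan a _ ⟩
    ¬' a ∨ ¬' (a ∨ b)     ≡⟨ cong (¬' a ∨_) (¬-∨ a b) ⟩
    ¬' a ∨ (¬' a ∧ ¬' b)  ≡⟨ absorb _ _ ⟩
    ¬' a                  ∎)

  ∨-idem : ∀ a → a ∨ a ≡ a
  ∨-idem a = trans (cong (a ∨_) (sym (T-identityʳ a))) (absorb a T)

  ∧-idem : ∀ a → a ∧ a ≡ a
  ∧-idem a = trans (cong (a ∧_) (sym (F-identityʳ a))) (∧-absorb a F)

  ∨-assoc : ∀ a b c → (a ∨ b) ∨ c ≡ a ∨ (b ∨ c)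
  ∨-assoc a b c = ¬-injective (begin
    ¬' ((a ∨ b) ∨ c)        ≡⟨ ¬-∨ _ _ ⟩
    ¬' (a ∨ b) ∧ ¬' c       ≡⟨ cong (_∧ ¬' c) (¬-∨ a b) ⟩
    (¬' a ∧ ¬' b) ∧ ¬' c    ≡⟨ ∧-assoc _ _ _ ⟩
    ¬' a ∧ (¬' b ∧ ¬' c)    ≡⟨ cong (¬' a ∧_) (sym (¬-∨ b c)) ⟩
    ¬' a ∧ ¬' (b ∨ c)       ≡⟨ sym (¬-∨ _ _) ⟩
    ¬' (a ∨ (b ∨ c))        ∎)

  F-zeroˡ : ∀ a → F ∧ a ≡ F
  F-zeroˡ a = trans (sym (F-identityˡ _)) (absorb F a)

  U-∨-zeroˡ : ∀ a → U ∨ a ≡ U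
  U-∨-zeroˡ a = trans (∨-relative U a) (trans (cong (λ u → U ∨ (u ∧ a)) U-fixed) (absorb U a))

  U-∧-zeroˡ : ∀ a → U ∧ a ≡ U
  U-∧-zeroˡ a = ¬-injective (begin
    ¬' (U ∧ a)    ≡⟨ deMorgan U a ⟩
    ¬' U ∨ ¬' a   ≡⟨ cong (_∨ ¬' a) U-fixed ⟩
    U ∨ ¬' a      ≡⟨ U-∨-zeroˡ _ ⟩
    U             ≡⟨ sym U-fixed ⟩
    ¬' U          ∎)

  ∨-conicalˡ : ∀ a b → a ∨ b ≡ F → a ≡ F
  ∨-conicalˡ a b e = ¬-injective (trans ¬a≡T (sym ¬F≡T))
    where
    ¬a∧¬b≡T : ¬' a ∧ ¬' b ≡ T
    ¬a∧¬b≡T = trans (sym (¬-∨ a b)) (trans (cong ¬' e) ¬F≡T)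
    ¬a≡T : ¬' a ≡ T
    ¬a≡T = begin
      ¬' a                  ≡⟨ sym (T-identityʳ _) ⟩
      ¬' a ∧ T              ≡⟨ cong (¬' a ∧_) (sym ¬a∧¬b≡T) ⟩
      ¬' a ∧ (¬' a ∧ ¬' b)  ≡⟨ sym (∧-assoc _ _ _) ⟩
      (¬' a ∧ ¬' a) ∧ ¬' b  ≡⟨ cong (_∧ ¬' b) (∧-idem _) ⟩
      ¬' a ∧ ¬' b           ≡⟨ ¬a∧¬b≡T ⟩
      T                     ∎

  fixed-point-of-¬ : ∀ x → x ≡ ¬' x → x ≡ U
  fixed-point-of-¬ x e = begin
    x                  ≡⟨ sym x∨U≡x ⟩
    x ∨ U              ≡⟨ sym (cong₂ _∨_ x∧U≡x (U-∧-zeroˡ x)) ⟩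
    (x ∧ U) ∨ (U ∧ x)  ≡⟨ ∧-comm-∨ x U ⟩
    (U ∧ x) ∨ (x ∧ U)  ≡⟨ cong (_∨ (x ∧ U)) (U-∧-zeroˡ x) ⟩
    U ∨ (x ∧ U)        ≡⟨ U-∨-zeroˡ _ ⟩
    U                  ∎
    where
    x∧U≡x : x ∧ U ≡ x
    x∧U≡x = trans (∧-relative x U) (trans (cong (λ u → x ∧ (u ∨ U)) (sym e)) (∧-absorb x U))
    x∨U≡x : x ∨ U ≡ x
    x∨U≡x = trans (∨-relative x U) (trans (cong (λ u → x ∨ (u ∧ U)) (sym e)) (absorb x U))

  absorbs-F-T⇒∨¬ : ∀ y → y ≡ y ∧ F → y ≡ y ∨ T → y ≡ y ∨ ¬' y
  absorbs-F-T⇒∨¬ y y∧F y∨T = begin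
    y                          ≡⟨ y∧F ⟩
    y ∧ F                      ≡⟨ cong (_∧ F) y∨T ⟩
    (y ∨ T) ∧ F                ≡⟨ ∨-∧-distribʳ _ _ _ ⟩
    (y ∧ F) ∨ (¬' y ∧ (T ∧ F)) ≡⟨ cong₂ (λ u v → u ∨ (¬' y ∧ v)) (sym y∧F) (T-identityˡ F) ⟩
    y ∨ (¬' y ∧ F)             ≡⟨ cong (y ∨_) (sym ¬y∧F) ⟩
    y ∨ ¬' y                   ∎
    where
    ¬y∧F : ¬' y ≡ ¬' y ∧ F
    ¬y∧F = trans (cong ¬' y∨T) (trans (¬-∨ y T) (cong (¬' y ∧_) ¬T≡F))

  absorbs-F-T⇒U : ∀ x → x ≡ x ∧ F → x ≡ x ∨ T → x ≡ U
  absorbs-F-T⇒U x x∧F x∨T = fixed-point-of-¬ x x≡¬x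
    where
    ¬x∧F : ¬' x ≡ ¬' x ∧ F
    ¬x∧F = trans (cong ¬' x∨T) (trans (¬-∨ x T) (cong (¬' x ∧_) ¬T≡F))
    ¬x∨T : ¬' x ≡ ¬' x ∨ T
    ¬x∨T = trans (cong ¬' x∧F) (trans (deMorgan x F) (cong (¬' x ∨_) ¬F≡T))
    x≡x∨¬x : x ≡ x ∨ ¬' x
    x≡x∨¬x = absorbs-F-T⇒∨¬ x x∧F x∨T
    ¬x≡¬x∨x : ¬' x ≡ ¬' x ∨ x
    ¬x≡¬x∨x = trans (absorbs-F-T⇒∨¬ (¬' x) ¬x∧F ¬x∨T) (cong (¬' x ∨_) (¬¬-id x))
    x∧¬x≡x : x ∧ ¬' x ≡ x
    x∧¬x≡x = trans (cong (x ∧_) ¬x≡¬x∨x) (trans (sym (∧-relative x x)) (∧-idem x))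
    ¬x∧x≡¬x : ¬' x ∧ x ≡ ¬' x
    ¬x∧x≡¬x = begin
      ¬' x ∧ x                  ≡⟨ cong (¬' x ∧_) x≡x∨¬x ⟩
      ¬' x ∧ (x ∨ ¬' x)         ≡⟨ cong (λ u → ¬' x ∧ (u ∨ ¬' x)) (sym (¬¬-id x)) ⟩
      ¬' x ∧ (¬' (¬' x) ∨ ¬' x) ≡⟨ sym (∧-relative _ _) ⟩
      ¬' x ∧ ¬' x               ≡⟨ ∧-idem _ ⟩
      ¬' x                      ∎
    x≡¬x : x ≡ ¬' x
    x≡¬x = begin
      x                      ≡⟨ x≡x∨¬x ⟩
      x ∨ ¬' x               ≡⟨ sym (cong₂ _∨_ x∧¬x≡x ¬x∧x≡¬x) ⟩
      (x ∧ ¬' x) ∨ (¬' x ∧ x) ≡⟨ ∧-comm-∨ x (¬' x) ⟩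
      (¬' x ∧ x) ∨ (x ∧ ¬' x) ≡⟨ cong₂ _∨_ ¬x∧x≡¬x x∧¬x≡x ⟩
      ¬' x ∨ x               ≡⟨ sym ¬x≡¬x∨x ⟩
      ¬' x                   ∎

  ≤⇒∧≡ : ∀ x y → x ∨ y ≡ y → x ∧ y ≡ x
  ≤⇒∧≡ x y le = trans (cong (x ∧_) (sym le)) (∧-absorb x y)

  module SharpElement (d : Carrier) (sharp : (d ∨ ¬' d) ≡ T) where

    ¬d∧d≡F : ¬' d ∧ d ≡ F
    ¬d∧d≡F = begin
      ¬' d ∧ d          ≡⟨ cong (¬' d ∧_) (sym (¬¬-id d)) ⟩
      ¬' d ∧ ¬' (¬' d)  ≡⟨ sym (¬-∨ d (¬' d)) ⟩
      ¬' (d ∨ ¬' d)     ≡⟨ cong ¬' sharp ⟩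
      ¬' T              ≡⟨ ¬T≡F ⟩
      F                 ∎

    split : ∀ z → z ≡ (d ∧ z) ∨ (¬' d ∧ z)
    split z = begin
      z                                ≡⟨ sym (T-identityˡ z) ⟩
      T ∧ z                            ≡⟨ cong (_∧ z) (sym sharp) ⟩
      (d ∨ ¬' d) ∧ z                   ≡⟨ ∨-∧-distribʳ _ _ _ ⟩
      (d ∧ z) ∨ (¬' d ∧ (¬' d ∧ z))    ≡⟨ cong ((d ∧ z) ∨_) (sym (∧-assoc _ _ _)) ⟩
      (d ∧ z) ∨ ((¬' d ∧ ¬' d) ∧ z)    ≡⟨ cong (λ u → (d ∧ z) ∨ (u ∧ z)) (∧-idem _) ⟩
      (d ∧ z) ∨ (¬' d ∧ z)             ∎

    ¬d∨d≡T : ¬' d ∨ d ≡ T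
    ¬d∨d≡T = begin
      p                      ≡⟨ split p ⟩
      (d ∧ p) ∨ (¬' d ∧ p)   ≡⟨ cong₂ _∨_ (sym (∧-relative d d)) (∧-absorb (¬' d) d) ⟩
      (d ∧ d) ∨ ¬' d         ≡⟨ cong (_∨ ¬' d) (∧-idem d) ⟩
      d ∨ ¬' d               ≡⟨ sharp ⟩
      T                      ∎
      where
      p = ¬' d ∨ d

    d∧¬d≡F : d ∧ ¬' d ≡ F
    d∧¬d≡F = begin
      d ∧ ¬' d          ≡⟨ cong (_∧ ¬' d) (sym (¬¬-id d)) ⟩
      ¬' (¬' d) ∧ ¬' d  ≡⟨ sym (¬-∨ _ _) ⟩
      ¬' (¬' d ∨ d)     ≡⟨ cong ¬' ¬d∨d≡T ⟩
      ¬' T              ≡⟨ ¬T≡F ⟩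
      F                 ∎

    ¬-sharp : (¬' d ∨ ¬' (¬' d)) ≡ T
    ¬-sharp = trans (cong (¬' d ∨_) (¬¬-id d)) ¬d∨d≡T

    d∧F≡F : d ∧ F ≡ F
    d∧F≡F = trans (∧-relative d F) (trans (cong (d ∧_) (F-identityʳ _)) d∧¬d≡F)

    ∧-fixed⇒∧¬≡F : ∀ b → d ∧ b ≡ d → d ∧ ¬' b ≡ F
    ∧-fixed⇒∧¬≡F b e = begin
      d ∧ ¬' b           ≡⟨ ∧-relative d _ ⟩
      d ∧ (¬' d ∨ ¬' b)  ≡⟨ cong (d ∧_) (sym (deMorgan d b)) ⟩
      d ∧ ¬' (d ∧ b)     ≡⟨ cong (λ u → d ∧ ¬' u) e ⟩
      d ∧ ¬' d           ≡⟨ d∧¬d≡F ⟩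
      F                  ∎

    ∧¬≡F⇒∧-fixed : ∀ b → d ∧ ¬' b ≡ F → d ∧ b ≡ d
    ∧¬≡F⇒∧-fixed b e = begin
      d ∧ b                   ≡⟨ ∧-relative d b ⟩
      d ∧ (¬' d ∨ b)          ≡⟨ cong (λ u → d ∧ (¬' d ∨ u)) (sym (¬¬-id b)) ⟩
      d ∧ (¬' d ∨ ¬' (¬' b))  ≡⟨ cong (d ∧_) (sym (deMorgan d (¬' b))) ⟩
      d ∧ ¬' (d ∧ ¬' b)       ≡⟨ cong (λ u → d ∧ ¬' u) e ⟩
      d ∧ ¬' F                ≡⟨ cong (d ∧_) ¬F≡T ⟩
      d ∧ T                   ≡⟨ T-identityʳ d ⟩
      d                       ∎

    ∧-≤ : ∀ a → (d ∧ a) ∨ a ≡ a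
    ∧-≤ a = begin
      (d ∧ a) ∨ a                          ≡⟨ cong ((d ∧ a) ∨_) (split a) ⟩
      (d ∧ a) ∨ ((d ∧ a) ∨ (¬' d ∧ a))     ≡⟨ sym (∨-assoc _ _ _) ⟩
      ((d ∧ a) ∨ (d ∧ a)) ∨ (¬' d ∧ a)     ≡⟨ cong (_∨ (¬' d ∧ a)) (∨-idem _) ⟩
      (d ∧ a) ∨ (¬' d ∧ a)                 ≡⟨ sym (split a) ⟩
      a                                    ∎

    ∧-fixed⇒∨-absorbs : ∀ c → d ∧ c ≡ c → d ∨ c ≡ d
    ∧-fixed⇒∨-absorbs c e = begin
      d ∨ c                ≡⟨ ∨-relative d c ⟩
      d ∨ (¬' d ∧ c)       ≡⟨ cong (λ u → d ∨ (¬' d ∧ u)) (sym e) ⟩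
      d ∨ (¬' d ∧ (d ∧ c)) ≡⟨ cong (d ∨_) (sym (∧-assoc _ _ _)) ⟩
      d ∨ ((¬' d ∧ d) ∧ c) ≡⟨ cong (λ u → d ∨ (u ∧ c)) ¬d∧d≡F ⟩
      d ∨ (F ∧ c)          ≡⟨ cong (d ∨_) (F-zeroˡ c) ⟩
      d ∨ F                ≡⟨ F-identityʳ d ⟩
      d                    ∎

  ≤-sharp : ∀ x y → x ∨ y ≡ y → (y ∨ ¬' y) ≡ T → (x ∨ ¬' x) ≡ T
  ≤-sharp x y le y-sharp =
    trans (cong (_∨ ¬' x) (sym (¬¬-id x))) (SharpElement.¬d∨d≡T (¬' x) ¬x-sharp)
    where
    open SharpElement y y-sharp using (d∧F≡F)
    x∧F∨¬x∧F≡F : (x ∧ F) ∨ (¬' x ∧ F) ≡ F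
    x∧F∨¬x∧F≡F = begin
      (x ∧ F) ∨ (¬' x ∧ F)       ≡⟨ cong (λ u → (x ∧ F) ∨ (¬' x ∧ u)) (sym d∧F≡F) ⟩
      (x ∧ F) ∨ (¬' x ∧ (y ∧ F)) ≡⟨ sym (∨-∧-distribʳ _ _ _) ⟩
      (x ∨ y) ∧ F                ≡⟨ cong (_∧ F) le ⟩
      y ∧ F                      ≡⟨ d∧F≡F ⟩
      F                          ∎
    x∧¬x≡F : x ∧ ¬' x ≡ F
    x∧¬x≡F = trans (cong (x ∧_) (sym (F-identityʳ _)))
                   (trans (sym (∧-relative x F)) (∨-conicalˡ _ _ x∧F∨¬x∧F≡F))
    ¬x-sharp : (¬' x ∨ ¬' (¬' x)) ≡ T
    ¬x-sharp = trans (sym (deMorgan x (¬' x))) (trans (cong ¬' x∧¬x≡F) ¬F≡T)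

  sharp-∧-antisym : ∀ b c → (b ∨ ¬' b) ≡ T → (c ∨ ¬' c) ≡ T →
                    b ∧ c ≡ c → c ∧ b ≡ b → c ≡ b
  sharp-∧-antisym b c b-sharp c-sharp bc cb = begin
    c                  ≡⟨ sym (SharpElement.∧-fixed⇒∨-absorbs c c-sharp b cb) ⟩
    c ∨ b              ≡⟨ cong₂ _∨_ (sym bc) (sym cb) ⟩
    (b ∧ c) ∨ (c ∧ b)  ≡⟨ ∧-comm-∨ b c ⟩
    (c ∧ b) ∨ (b ∧ c)  ≡⟨ cong₂ _∨_ cb bc ⟩
    b ∨ c              ≡⟨ SharpElement.∧-fixed⇒∨-absorbs b b-sharp c bc ⟩
    b                  ∎

module AdaLaws {ℓ : Level} (M : Ada ℓ) where
  open Ada M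
  open AdaNotions M
  open CAlgebraLaws tfu
  open ≡-Reasoning

  ∧-↓-self : ∀ a → a ∧ (a ↓) ≡ a
  ∧-↓-self a = begin
    a ∧ (a ↓)          ≡⟨ cong (λ u → a ∧ (u ↓)) (sym (T-identityʳ a)) ⟩
    a ∧ ((a ∧ T) ↓)    ≡⟨ sym (↓-∧ a T) ⟩
    a ∧ (T ↓)          ≡⟨ cong (a ∧_) T↓ ⟩
    a ∧ T              ≡⟨ T-identityʳ a ⟩
    a                  ∎

  ↓-∧-self : ∀ a → (a ↓) ∧ a ≡ a ↓
  ↓-∧-self a = trans (cong ((a ↓) ∧_) (↓-∨ a)) (∧-absorb _ _)

  ↓≡F⇒∧F : ∀ a → a ↓ ≡ F → a ≡ a ∧ F
  ↓≡F⇒∧F a h = sym (trans (cong (a ∧_) (sym h)) (∧-↓-self a))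

  sharp-↓ : ∀ s → Sharp s → s ↓ ≡ s
  sharp-↓ s h = begin
    s ↓                               ≡⟨ split (s ↓) ⟩
    (s ∧ (s ↓)) ∨ (¬' s ∧ (s ↓))      ≡⟨ cong₂ _∨_ (∧-↓-self s) (↓-∧ (¬' s) s) ⟩
    s ∨ (¬' s ∧ ((¬' s ∧ s) ↓))       ≡⟨ cong (λ u → s ∨ (¬' s ∧ (u ↓))) ¬d∧d≡F ⟩
    s ∨ (¬' s ∧ (F ↓))                ≡⟨ cong (λ u → s ∨ (¬' s ∧ u)) F↓ ⟩
    s ∨ (¬' s ∧ F)                    ≡⟨ cong (s ∨_) (SharpElement.d∧F≡F (¬' s) ¬-sharp) ⟩
    s ∨ F                             ≡⟨ F-identityʳ s ⟩
    s                                 ∎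
    where open SharpElement s h

  sharp-∧U-↓ : ∀ d → Sharp d → (d ∧ U) ↓ ≡ F
  sharp-∧U-↓ d h = begin
    z                                              ≡⟨ split z ⟩
    (d ∧ z) ∨ (¬' d ∧ z)                           ≡⟨ cong₂ _∨_ (sym (↓-∧ d U)) (↓-∧ (¬' d) (d ∧ U)) ⟩
    (d ∧ (U ↓)) ∨ (¬' d ∧ ((¬' d ∧ (d ∧ U)) ↓))    ≡⟨ cong (λ u → (d ∧ (U ↓)) ∨ (¬' d ∧ (u ↓))) (sym (∧-assoc _ _ _)) ⟩
    (d ∧ (U ↓)) ∨ (¬' d ∧ (((¬' d ∧ d) ∧ U) ↓))    ≡⟨ cong₂ (λ u v → (d ∧ u) ∨ (¬' d ∧ ((v ∧ U) ↓))) U↓ ¬d∧d≡F ⟩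
    (d ∧ F) ∨ (¬' d ∧ ((F ∧ U) ↓))                 ≡⟨ cong (λ u → (d ∧ F) ∨ (¬' d ∧ (u ↓))) (F-zeroˡ U) ⟩
    (d ∧ F) ∨ (¬' d ∧ (F ↓))                       ≡⟨ cong (λ u → (d ∧ F) ∨ (¬' d ∧ u)) F↓ ⟩
    (d ∧ F) ∨ (¬' d ∧ F)                           ≡⟨ cong₂ _∨_ d∧F≡F (SharpElement.d∧F≡F (¬' d) ¬-sharp) ⟩
    F ∨ F                                          ≡⟨ ∨-idem F ⟩
    F                                              ∎
    where
    open SharpElement d h
    z = (d ∧ U) ↓

  ≤-↓≡F : ∀ x y → x ≤ y → y ↓ ≡ F → x ↓ ≡ F
  ≤-↓≡F x y le h = begin
    x ↓                  ≡⟨ sym x↓∧y ⟩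
    (x ↓) ∧ y            ≡⟨ cong ((x ↓) ∧_) (↓≡F⇒∧F y h) ⟩
    (x ↓) ∧ (y ∧ F)      ≡⟨ sym (∧-assoc _ _ _) ⟩
    ((x ↓) ∧ y) ∧ F      ≡⟨ cong (_∧ F) x↓∧y ⟩
    (x ↓) ∧ F            ≡⟨ SharpElement.d∧F≡F (x ↓) (↓-sharp x) ⟩
    F                    ∎
    where
    x↓∧y : (x ↓) ∧ y ≡ x ↓
    x↓∧y = begin
      (x ↓) ∧ y                    ≡⟨ cong ((x ↓) ∧_) (sym le) ⟩
      (x ↓) ∧ (x ∨ y)              ≡⟨ ∧-distribˡ-∨ _ _ _ ⟩
      ((x ↓) ∧ x) ∨ ((x ↓) ∧ y)    ≡⟨ cong (_∨ ((x ↓) ∧ y)) (↓-∧-self x) ⟩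
      (x ↓) ∨ ((x ↓) ∧ y)          ≡⟨ absorb _ _ ⟩
      x ↓                          ∎

  _↑ : Carrier → Carrier
  a ↑ = ¬' ((¬' a) ↓)

  ↑-sharp : ∀ a → Sharp (a ↑)
  ↑-sharp a = trans (cong ((a ↑) ∨_) (¬¬-id _)) (SharpElement.¬d∨d≡T _ (↓-sharp (¬' a)))

  F↑ : F ↑ ≡ F
  F↑ = trans (cong (λ u → ¬' (u ↓)) ¬F≡T) (trans (cong ¬' T↓) ¬T≡F)

  ↑-monotone : ∀ x y → x ≤ y → (y ↑) ∧ (x ↑) ≡ x ↑
  ↑-monotone x y le = begin
    ¬' Z ∧ ¬' (p ↓)    ≡⟨ sym (¬-∨ Z (p ↓)) ⟩
    ¬' (Z ∨ (p ↓))     ≡⟨ cong ¬' (sym p↓≡Z∨p↓) ⟩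
    ¬' (p ↓)           ∎
    where
    p = ¬' x
    q = ¬' y
    Z = q ↓
    open SharpElement Z (↓-sharp q)
    q≡p∧q : q ≡ p ∧ q
    q≡p∧q = trans (cong ¬' (sym le)) (¬-∨ x y)
    Z∧¬p≡F : Z ∧ ¬' p ≡ F
    Z∧¬p≡F = ∨-conicalˡ _ _ (begin
      (Z ∧ ¬' p) ∨ (Z ∧ ¬' q) ≡⟨ sym (∧-distribˡ-∨ _ _ _) ⟩
      Z ∧ (¬' p ∨ ¬' q)       ≡⟨ cong (Z ∧_) (sym (deMorgan p q)) ⟩
      Z ∧ ¬' (p ∧ q)          ≡⟨ ∧-fixed⇒∧¬≡F _ (trans (cong (Z ∧_) (sym q≡p∧q)) (↓-∧-self q)) ⟩
      F                       ∎)
    Z∧p↓≡Z : Z ∧ (p ↓) ≡ Z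
    Z∧p↓≡Z = trans (↓-∧ Z p) (trans (cong (λ u → Z ∧ (u ↓)) (∧¬≡F⇒∧-fixed p Z∧¬p≡F)) (∧-↓-self Z))
    p↓≡Z∨p↓ : p ↓ ≡ Z ∨ (p ↓)
    p↓≡Z∨p↓ = trans (split (p ↓)) (trans (cong (_∨ (¬' Z ∧ (p ↓))) Z∧p↓≡Z) (sym (∨-relative Z (p ↓))))

  ∧U-↑ : ∀ b → Sharp b → (b ∧ U) ↑ ≡ b
  ∧U-↑ b h = begin
    ¬' ((¬' (b ∧ U)) ↓)  ≡⟨ cong (λ u → ¬' (u ↓)) (trans (deMorgan b U) (cong (γ ∨_) U-fixed)) ⟩
    ¬' x                 ≡⟨ cong ¬' x≡γ ⟩
    ¬' γ                 ≡⟨ ¬¬-id b ⟩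
    b                    ∎
    where
    γ = ¬' b
    γ-sharp : Sharp γ
    γ-sharp = SharpElement.¬-sharp b h
    ¬γ-sharp : Sharp (¬' γ)
    ¬γ-sharp = SharpElement.¬-sharp γ γ-sharp
    x = (γ ∨ U) ↓
    γ∧x≡γ : γ ∧ x ≡ γ
    γ∧x≡γ = trans (↓-∧ γ (γ ∨ U)) (trans (cong (λ u → γ ∧ (u ↓)) (∧-absorb γ U)) (∧-↓-self γ))
    ¬γ∧x≡F : ¬' γ ∧ x ≡ F
    ¬γ∧x≡F = begin
      ¬' γ ∧ x                               ≡⟨ ↓-∧ (¬' γ) (γ ∨ U) ⟩
      ¬' γ ∧ ((¬' γ ∧ (γ ∨ U)) ↓)            ≡⟨ cong (λ u → ¬' γ ∧ ((¬' γ ∧ (u ∨ U)) ↓)) (sym (¬¬-id γ)) ⟩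
      ¬' γ ∧ ((¬' γ ∧ (¬' (¬' γ) ∨ U)) ↓)    ≡⟨ cong (λ u → ¬' γ ∧ (u ↓)) (sym (∧-relative (¬' γ) U)) ⟩
      ¬' γ ∧ ((¬' γ ∧ U) ↓)                  ≡⟨ cong (¬' γ ∧_) (sharp-∧U-↓ (¬' γ) ¬γ-sharp) ⟩
      ¬' γ ∧ F                               ≡⟨ SharpElement.d∧F≡F (¬' γ) ¬γ-sharp ⟩
      F                                      ∎
    x≡γ : x ≡ γ
    x≡γ = trans (SharpElement.split γ γ-sharp x) (trans (cong₂ _∨_ γ∧x≡γ ¬γ∧x≡F) (F-identityʳ γ))

  ↑-∧U : ∀ a → a ↓ ≡ F → (a ↑) ∧ U ≡ a
  ↑-∧U a h = begin
    t ∧ U                        ≡⟨ cong (t ∧_) (sym a∨U≡U) ⟩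
    t ∧ (a ∨ U)                  ≡⟨ ∧-distribˡ-∨ _ _ _ ⟩
    (t ∧ a) ∨ (t ∧ U)            ≡⟨ cong (_∨ (t ∧ U)) t∧a≡a ⟩
    a ∨ (t ∧ U)                  ≡⟨ ∨-relative a _ ⟩
    a ∨ (¬' a ∧ (t ∧ U))         ≡⟨ cong (a ∨_) (sym (∧-assoc _ _ _)) ⟩
    a ∨ ((¬' a ∧ t) ∧ U)         ≡⟨ cong (λ u → a ∨ (u ∧ U)) ¬a∧t≡¬a∧F ⟩
    a ∨ ((¬' a ∧ F) ∧ U)         ≡⟨ cong (a ∨_) (∧-assoc _ _ _) ⟩
    a ∨ (¬' a ∧ (F ∧ U))         ≡⟨ cong (λ u → a ∨ (¬' a ∧ u)) (F-zeroˡ U) ⟩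
    a ∨ (¬' a ∧ F)               ≡⟨ sym (∨-relative a F) ⟩
    a ∨ F                        ≡⟨ F-identityʳ a ⟩
    a                            ∎
    where
    s = (¬' a) ↓
    t = ¬' s
    open SharpElement s (↓-sharp (¬' a))
    a∧F : a ≡ a ∧ F
    a∧F = ↓≡F⇒∧F a h
    -- a ∨ U absorbs F and T, hence equals U.
    a∨U≡U : a ∨ U ≡ U
    a∨U≡U = absorbs-F-T⇒U _
      (sym (begin
        (a ∨ U) ∧ F                 ≡⟨ ∨-∧-distribʳ _ _ _ ⟩
        (a ∧ F) ∨ (¬' a ∧ (U ∧ F))  ≡⟨ cong₂ (λ u v → u ∨ (¬' a ∧ v)) (sym a∧F) (U-∧-zeroˡ F) ⟩
        a ∨ (¬' a ∧ U)              ≡⟨ sym (∨-relative a U) ⟩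
        a ∨ U                       ∎))
      (sym (trans (∨-assoc _ _ _) (cong (a ∨_) (U-∨-zeroˡ T))))
    ¬a∧t≡¬a∧F : ¬' a ∧ t ≡ ¬' a ∧ F
    ¬a∧t≡¬a∧F = begin
      ¬' a ∧ t                ≡⟨ cong (_∧ t) (sym (∧-↓-self (¬' a))) ⟩
      (¬' a ∧ s) ∧ t          ≡⟨ ∧-assoc _ _ _ ⟩
      ¬' a ∧ (s ∧ t)          ≡⟨ cong (¬' a ∧_) d∧¬d≡F ⟩
      ¬' a ∧ F                ∎
    s∧a≡F : s ∧ a ≡ F
    s∧a≡F = trans (cong (s ∧_) (sym (¬¬-id a))) (∧-fixed⇒∧¬≡F (¬' a) (↓-∧-self (¬' a)))
    t∧a≡a : t ∧ a ≡ a
    t∧a≡a = sym (trans (split a) (trans (cong (_∨ (t ∧ a)) s∧a≡F) (F-identityˡ _)))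

  -- A non-sharp atom has no sharp part, since its sharp part a ↓ lies below it.
  nonsharp-atom-↓ : ∀ a → IsAtom a → ¬ Sharp a → a ↓ ≡ F
  nonsharp-atom-↓ a (_ , below-a) a-nonsharp =
    below-a (a ↓) (F-identityˡ _) (sym (↓-∨ a)) (λ e → a-nonsharp (subst Sharp e (↓-sharp a)))

  ↑-atom : ∀ a → IsAtom a → ¬ Sharp a → IsAtom (a ↑)
  ↑-atom a (a≢F , below-a) a-nonsharp = a↑≢F , below-a↑
    where
    a↑∧U≡a : (a ↑) ∧ U ≡ a
    a↑∧U≡a = ↑-∧U a (nonsharp-atom-↓ a (a≢F , below-a) a-nonsharp)
    a↑≢F : ¬ (a ↑ ≡ F)
    a↑≢F e = a≢F (trans (sym a↑∧U≡a) (trans (cong (_∧ U) e) (F-zeroˡ U)))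
    -- x is sharp, so x = (x ∧ U) ↑ = (x ∧ a) ↑, and x ∧ a lies below the atom a.
    below-a↑ : ∀ x → F ≤ x → x ≤ (a ↑) → ¬ (x ≡ a ↑) → x ≡ F
    below-a↑ x _ x≤a↑ x≢a↑ = trans (sym x≡[x∧a]↑) (trans (cong _↑ x∧a≡F) F↑)
      where
      x-sharp : Sharp x
      x-sharp = ≤-sharp x (a ↑) x≤a↑ (↑-sharp a)
      x∧a≡x∧U : x ∧ a ≡ x ∧ U
      x∧a≡x∧U = begin
        x ∧ a               ≡⟨ cong (x ∧_) (sym a↑∧U≡a) ⟩
        x ∧ ((a ↑) ∧ U)     ≡⟨ sym (∧-assoc _ _ _) ⟩
        (x ∧ (a ↑)) ∧ U     ≡⟨ cong (_∧ U) (≤⇒∧≡ x (a ↑) x≤a↑) ⟩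
        x ∧ U               ∎
      x≡[x∧a]↑ : (x ∧ a) ↑ ≡ x
      x≡[x∧a]↑ = trans (cong _↑ x∧a≡x∧U) (∧U-↑ x x-sharp)
      x∧a≢a : ¬ (x ∧ a ≡ a)
      x∧a≢a e = x≢a↑ (trans (sym x≡[x∧a]↑) (cong _↑ e))
      x∧a≡F : x ∧ a ≡ F
      x∧a≡F = below-a (x ∧ a) (F-identityˡ _) (SharpElement.∧-≤ x x-sharp a) x∧a≢a

  ∧U-atom : ∀ b → IsAtom b → Sharp b → IsAtom (b ∧ U) × ¬ Sharp (b ∧ U)
  ∧U-atom b (b≢F , below-b) b-sharp = (a≢F , below-a) , a-nonsharp
    where
    a = b ∧ U
    a↓≡F : a ↓ ≡ F
    a↓≡F = sharp-∧U-↓ b b-sharp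
    a≢F : ¬ (a ≡ F)
    a≢F e = b≢F (trans (sym (∧U-↑ b b-sharp)) (trans (cong _↑ e) F↑))
    a-nonsharp : ¬ Sharp a
    a-nonsharp a-sharp = a≢F (trans (sym (sharp-↓ a a-sharp)) a↓≡F)
    -- x ↑ is a sharp element below b, hence F or b; the latter would give x = a.
    below-a : ∀ x → F ≤ x → x ≤ a → ¬ (x ≡ a) → x ≡ F
    below-a x _ x≤a x≢a = trans (sym x↑∧U≡x) (trans (cong (_∧ U) c≡F) (F-zeroˡ U))
      where
      x↑∧U≡x : (x ↑) ∧ U ≡ x
      x↑∧U≡x = ↑-∧U x (≤-↓≡F x a x≤a a↓≡F)
      c = x ↑
      c-sharp : Sharp c
      c-sharp = ↑-sharp x
      b∧c≡c : b ∧ c ≡ c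
      b∧c≡c = trans (cong (_∧ c) (sym (∧U-↑ b b-sharp))) (↑-monotone x a x≤a)
      c∧b≢b : ¬ (c ∧ b ≡ b)
      c∧b≢b e = x≢a (trans (sym x↑∧U≡x)
                          (cong (_∧ U) (sharp-∧-antisym b c b-sharp c-sharp b∧c≡c e)))
      c∧b≡F : c ∧ b ≡ F
      c∧b≡F = below-b (c ∧ b) (F-identityˡ _) (SharpElement.∧-≤ c c-sharp b) c∧b≢b
      c≡F : c ≡ F
      c≡F = begin
        c               ≡⟨ sym (∧-idem c) ⟩
        c ∧ c           ≡⟨ cong (c ∧_) (sym b∧c≡c) ⟩
        c ∧ (b ∧ c)     ≡⟨ sym (∧-assoc _ _ _) ⟩
        (c ∧ b) ∧ c     ≡⟨ cong (_∧ c) c∧b≡F ⟩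
        F ∧ c           ≡⟨ F-zeroˡ c ⟩
        F               ∎

theorem2p28 : ∀ {ℓ : Level} (M : Ada ℓ) → AdaBij.BijAtoms M
theorem2p28 M = record { to = to ; injective = injective ; surjective = surjective }
  where
  open Ada M
  open AdaNotions M
  open AdaLaws M

  to : AtomsNonSharp → AtomsSharp
  to (a , a-atom , a-nonsharp) = a ↑ , ↑-atom a a-atom a-nonsharp , ↑-sharp a

  recover : ∀ (x : AtomsNonSharp) → (proj₁ (to x)) ∧ U ≡ proj₁ x
  recover (a , a-atom , a-nonsharp) = ↑-∧U a (nonsharp-atom-↓ a a-atom a-nonsharp)

  injective : ∀ (x y : AtomsNonSharp) → proj₁ (to x) ≡ proj₁ (to y) → proj₁ x ≡ proj₁ y
  injective x y e = trans (sym (recover x)) (trans (cong (_∧ U) e) (recover y))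

  surjective : ∀ (y : AtomsSharp) → Σ AtomsNonSharp (λ x → proj₁ (to x) ≡ proj₁ y)
  surjective (b , b-atom , b-sharp) = (b ∧ U , ∧U-atom b b-atom b-sharp) , ∧U-↑ b b-sharp
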